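{- Let $n\ge1$ and let $G$ be the sibling tree $ST_n$. Then every minimum locating-dominating set of $G$ contains at least $2^{n-1}$ vertices from level $n$.
   Context: The sibling tree $ST_n$ has vertex set $\{1,\dots,2^{n+1}-1\}$; its edges are the complete binary tree edges $\{x,2x\},\{x,2x+1\}$ for $1\le x\le 2^n-1$ together with the sibling edges $\{2x,2x+1\}$ for $1\le x\le 2^n-1$. The root $1$ is at level $0$ and vertex $v$ is at level $i$ iff $2^i\le v\le 2^{i+1}-1$. A locating-dominating set is a set $S$ such that every vertex outside $S$ has a neighbor in $S$ and distinct $u,v\notin S$ satisfy $N(u)\cap S\ne N(v)\cap S$ (open neighborhoods); a minimum one is one of least cardinality. -}

module Defs where

open import Data.Nat using (ℕ; _+_; _*_; _^_; _≤_; _<_; _≤?_; _<?_)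
open import Data.Product using (Σ; _×_; ∃; ∃-syntax)
open import Data.Sum using (_⊎_)
open import Data.List using (List; length; filter)
open import Data.List.Membership.Propositional using (_∈_; _∉_)
open import Data.List.Relation.Unary.All using (All)
open import Data.List.Relation.Unary.Unique.Propositional using (Unique)
open import Relation.Binary.PropositionalEquality using (_≡_; _≢_)
open import Relation.Nullary using (¬_)
open import Relation.Nullary.Decidable using (_×-dec_)
open import Function.Bundles using (_⇔_)

Vertex : ℕ → ℕ → Set
Vertex n v = 1 ≤ v × v < 2 ^ (n + 1)

EdgeDir : ℕ → ℕ → ℕ → Set
EdgeDir n u v = ∃[ x ] (1 ≤ x × x < 2 ^ n ×
  ((u ≡ x × v ≡ 2 * x) ⊎ (u ≡ x × v ≡ 2 * x + 1) ⊎ (u ≡ 2 * x × v ≡ 2 * x + 1)))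

Adj : ℕ → ℕ → ℕ → Set
Adj n u v = EdgeDir n u v ⊎ EdgeDir n v u

IsVertexSet : ℕ → List ℕ → Set
IsVertexSet n S = Unique S × All (Vertex n) S

IsLocDom : ℕ → List ℕ → Set
IsLocDom n S =
  IsVertexSet n S ×
  ((v : ℕ) → Vertex n v → v ∉ S → ∃[ w ] (w ∈ S × Adj n w v)) ×
  ((u v : ℕ) → Vertex n u → Vertex n v → u ∉ S → v ∉ S → u ≢ v →
     ¬ ((w : ℕ) → w ∈ S → (Adj n w u ⇔ Adj n w v)))

IsMinLocDom : ℕ → List ℕ → Set
IsMinLocDom n S = IsLocDom n S × ((T : List ℕ) → IsLocDom n T → length S ≤ length T)

countLevel : ℕ → List ℕ → ℕ
countLevel n S = length (filter (λ v → (2 ^ n ≤? v) ×-dec (v <? 2 ^ (n + 1))) S)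

module Submission where

-- The reason is that the two children 2x and
-- 2x+1 of a vertex x on level n-1 are leaves and "twins": apart from each
-- other, both are adjacent exactly to their parent x.  A locating set must
-- separate any two twins, so it contains 2x or 2x+1.  There are 2^(n-1)
-- vertices on level n-1, their child pairs are disjoint, and so choosing one
-- child from S for each of them gives 2^(n-1) distinct elements of S on level n.

open import Defs
open import Data.Nat using (ℕ; _≤_; _^_; _∸_)
open import Data.List using (List)

open import Data.Nat using (suc; _+_; _*_; _<_; _≟_; _≤?_; _<?_)
open import Data.Nat.Properties
open import Data.Fin using (Fin; toℕ)
open import Data.Fin.Properties using (injective⇒≤; toℕ-injective; toℕ<n)
open import Data.List using (length; filter; lookup)
open import Data.List.Membership.Propositional using (_∈_)
open import Data.List.Membership.Propositional.Properties using (∈-filter⁺)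
open import Data.List.Membership.DecPropositional _≟_ using (_∈?_)
open import Data.List.Relation.Unary.Any using (index)
open import Data.List.Relation.Unary.Any.Properties using (lookup-index)
open import Data.Product using (_×_; _,_; proj₁; proj₂; ∃-syntax)
open import Data.Sum using (_⊎_; inj₁; inj₂)
open import Data.Empty using (⊥-elim)
open import Relation.Nullary using (Dec; yes; no; contradiction)
open import Relation.Nullary.Decidable using (_×-dec_)
open import Relation.Binary.PropositionalEquality
open import Function.Bundles using (_⇔_; mk⇔)
open import Function.Definitions using (Injective)

-- Pigeonhole for lists: an injective family of k members of xs forces
-- k ≤ length xs.  The positions of the members form an injection
-- Fin k → Fin (length xs).
injective-members-≤-length : ∀ {A : Set} {k} {xs : List A} (f : Fin k → A) →
  Injective _≡_ _≡_ f → (member : ∀ i → f i ∈ xs) → k ≤ length xs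
injective-members-≤-length {xs = xs} f f-inj member =
  injective⇒≤ {f = position} position-injective
  where
  position : Fin _ → Fin (length xs)
  position i = index (member i)
  position-injective : Injective _≡_ _≡_ position
  position-injective {i} {j} same = f-inj (begin
    f i                    ≡⟨ lookup-index (member i) ⟩
    lookup xs (position i) ≡⟨ cong (lookup xs) same ⟩
    lookup xs (position j) ≡⟨ lookup-index (member j) ⟨
    f j                    ∎)
    where open ≡-Reasoning

Child : ℕ → ℕ → Set
Child x c = c ≡ 2 * x ⊎ c ≡ 2 * x + 1

even≢odd′ : ∀ x y → 2 * x ≢ 2 * y + 1
even≢odd′ x y e = even≢odd x y (trans e (+-comm (2 * y) 1))

-- Distinct vertices have disjoint sets of children (c determines ⌊c/2⌋).
child-injective : ∀ {x y c} → Child x c → Child y c → x ≡ y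
child-injective {x} {y} (inj₁ p) (inj₁ q) = *-cancelˡ-≡ x y 2 (trans (sym p) q)
child-injective {x} {y} (inj₁ p) (inj₂ q) = ⊥-elim (even≢odd′ x y (trans (sym p) q))
child-injective {x} {y} (inj₂ p) (inj₁ q) = ⊥-elim (even≢odd′ y x (trans (sym q) p))
child-injective {x} {y} (inj₂ p) (inj₂ q) =
  *-cancelˡ-≡ x y 2 (+-cancelʳ-≡ 1 (2 * x) (2 * y) (trans (sym p) q))

OnLevel : ℕ → ℕ → Set
OnLevel k v = 2 ^ k ≤ v × v < 2 ^ (k + 1)

onLevel? : ∀ k v → Dec (OnLevel k v)
onLevel? k v = (2 ^ k ≤? v) ×-dec (v <? 2 ^ (k + 1))

2^[k+1]≡2*2^k : ∀ k → 2 ^ (k + 1) ≡ 2 * 2 ^ k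
2^[k+1]≡2*2^k k = cong (2 ^_) (+-comm k 1)

child-on-next-level : ∀ {k x c} → OnLevel k x → Child x c → OnLevel (suc k) c
child-on-next-level {k} {x} (lo , hi) child = below child , above child
  where
  hi′ : x < 2 ^ suc k
  hi′ = subst (x <_) (2^[k+1]≡2*2^k k) hi
  2x+1<2^[k+2] : 2 * x + 1 < 2 ^ (suc k + 1)
  2x+1<2^[k+2] = subst (2 * x + 1 <_) (sym (2^[k+1]≡2*2^k (suc k))) (begin-strict
    2 * x + 1     ≡⟨ +-comm (2 * x) 1 ⟩
    suc (2 * x)   <⟨ n<1+n _ ⟩
    2 + 2 * x     ≡⟨ *-suc 2 x ⟨
    2 * suc x     ≤⟨ *-monoʳ-≤ 2 hi′ ⟩
    2 * 2 ^ suc k ∎)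
    where open ≤-Reasoning
  below : ∀ {c} → Child x c → 2 ^ suc k ≤ c
  below (inj₁ refl) = *-monoʳ-≤ 2 lo
  below (inj₂ refl) = ≤-trans (*-monoʳ-≤ 2 lo) (m≤m+n (2 * x) 1)
  above : ∀ {c} → Child x c → c < 2 ^ (suc k + 1)
  above (inj₁ refl) = ≤-<-trans (m≤m+n (2 * x) 1) 2x+1<2^[k+2]
  above (inj₂ refl) = 2x+1<2^[k+2]

-- A vertex of level n-1 of ST_n: an internal vertex whose children are leaves.
LeafParent : ℕ → ℕ → Set
LeafParent n x = 1 ≤ x × x < 2 ^ n × 2 ^ n ≤ 2 * x

parent-adj-even : ∀ {n x} → LeafParent n x → Adj n x (2 * x)
parent-adj-even (x≥1 , x<2^n , _) = inj₁ (_ , x≥1 , x<2^n , inj₁ (refl , refl))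

parent-adj-odd : ∀ {n x} → LeafParent n x → Adj n x (2 * x + 1)
parent-adj-odd (x≥1 , x<2^n , _) = inj₁ (_ , x≥1 , x<2^n , inj₂ (inj₁ (refl , refl)))

-- A vertex c ≥ 2^n (a leaf) is never the lower end of an edge: those are < 2^n.
leaf≢internal : ∀ n {c y} → 2 ^ n ≤ c → y < 2 ^ n → c ≢ y
leaf≢internal n le lt e = <⇒≢ (<-≤-trans lt le) (sym e)

even-leaf-neighbours : ∀ {n x w} → 2 ^ n ≤ 2 * x → Adj n w (2 * x) →
  w ≡ x ⊎ w ≡ 2 * x + 1
even-leaf-neighbours {n} {x} le (inj₁ (y , _ , _ , inj₁ (refl , e))) =
  inj₁ (sym (child-injective {x} {y} (inj₁ refl) (inj₁ e)))
even-leaf-neighbours {n} {x} le (inj₁ (y , _ , _ , inj₂ (inj₁ (_ , e)))) = ⊥-elim (even≢odd′ x y e)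
even-leaf-neighbours {n} {x} le (inj₁ (y , _ , _ , inj₂ (inj₂ (_ , e)))) = ⊥-elim (even≢odd′ x y e)
even-leaf-neighbours {n} {x} le (inj₂ (y , _ , lt , inj₁ (e , _))) =
  ⊥-elim (leaf≢internal n le lt e)
even-leaf-neighbours {n} {x} le (inj₂ (y , _ , lt , inj₂ (inj₁ (e , _)))) =
  ⊥-elim (leaf≢internal n le lt e)
even-leaf-neighbours {n} {x} le (inj₂ (y , _ , _ , inj₂ (inj₂ (e , refl)))) =
  inj₂ (cong (λ t → 2 * t + 1) (sym (child-injective {x} {y} (inj₁ refl) (inj₁ e))))

odd-leaf-neighbours : ∀ {n x w} → 2 ^ n ≤ 2 * x → Adj n w (2 * x + 1) →
  w ≡ x ⊎ w ≡ 2 * x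
odd-leaf-neighbours {n} {x} le (inj₁ (y , _ , _ , inj₁ (_ , e))) = ⊥-elim (even≢odd′ y x (sym e))
odd-leaf-neighbours {n} {x} le (inj₁ (y , _ , _ , inj₂ (inj₁ (refl , e)))) =
  inj₁ (sym (child-injective {x} {y} (inj₂ refl) (inj₂ e)))
odd-leaf-neighbours {n} {x} le (inj₁ (y , _ , _ , inj₂ (inj₂ (refl , e)))) =
  inj₂ (cong (2 *_) (sym (child-injective {x} {y} (inj₂ refl) (inj₂ e))))
odd-leaf-neighbours {n} {x} le (inj₂ (y , _ , lt , inj₁ (e , _))) =
  ⊥-elim (leaf≢internal n (≤-trans le (m≤m+n (2 * x) 1)) lt e)
odd-leaf-neighbours {n} {x} le (inj₂ (y , _ , lt , inj₂ (inj₁ (e , _)))) =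
  ⊥-elim (leaf≢internal n (≤-trans le (m≤m+n (2 * x) 1)) lt e)
odd-leaf-neighbours {n} {x} le (inj₂ (y , _ , _ , inj₂ (inj₂ (e , _)))) = ⊥-elim (even≢odd′ y x (sym e))

sibling-leaves-twins : ∀ {n x} → LeafParent n x → ∀ w → w ≢ 2 * x → w ≢ 2 * x + 1 →
  Adj n w (2 * x) ⇔ Adj n w (2 * x + 1)
sibling-leaves-twins {n} {x} parent@(_ , _ , le) w w≢even w≢odd = mk⇔ to from
  where
  to : Adj n w (2 * x) → Adj n w (2 * x + 1)
  to a with even-leaf-neighbours {n} {x} le a
  ... | inj₁ refl = parent-adj-odd {n} {x} parent
  ... | inj₂ e    = contradiction e w≢odd
  from : Adj n w (2 * x + 1) → Adj n w (2 * x)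
  from a with odd-leaf-neighbours {n} {x} le a
  ... | inj₁ refl = parent-adj-even {n} {x} parent
  ... | inj₂ e    = contradiction e w≢even

-- A locating set meets every pair of twins: if u, v ∉ S, the twin property
-- makes N(u) ∩ S = N(v) ∩ S.
locDom-meets-twins : ∀ {n S u v} → IsLocDom n S → Vertex n u → Vertex n v → u ≢ v →
  (∀ w → w ≢ u → w ≢ v → Adj n w u ⇔ Adj n w v) → u ∈ S ⊎ v ∈ S
locDom-meets-twins {n} {S} {u} {v} (_ , _ , locating) vu vv u≢v twins with u ∈? S | v ∈? S
... | yes u∈S | _      = inj₁ u∈S
... | no _    | yes v∈S = inj₂ v∈S
... | no u∉S  | no v∉S  = ⊥-elim (locating u v vu vv u∉S v∉S u≢v same-trace)
  where
  same-trace : ∀ w → w ∈ S → Adj n w u ⇔ Adj n w v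
  same-trace w w∈S = twins w (λ { refl → u∉S w∈S }) (λ { refl → v∉S w∈S })

locDom-contains-child : ∀ {m S x} → IsLocDom (suc m) S → OnLevel m x →
  ∃[ c ] (Child x c × c ∈ S)
locDom-contains-child {m} {S} {x} ld onLevel@(lo , hi) =
  pick (locDom-meets-twins {suc m} {S} ld
          (vertex {2 * x} (inj₁ refl)) (vertex {2 * x + 1} (inj₂ refl))
          (even≢odd′ x x) (sibling-leaves-twins {suc m} {x} parent))
  where
  parent : LeafParent (suc m) x
  parent = ≤-trans (m^n>0 2 m) lo , subst (x <_) (2^[k+1]≡2*2^k m) hi , *-monoʳ-≤ 2 lo
  vertex : ∀ {c} → Child x c → Vertex (suc m) c
  vertex child with child-on-next-level {m} {x} onLevel child
  ... | lo′ , hi′ = ≤-trans (m^n>0 2 (suc m)) lo′ , hi′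
  pick : 2 * x ∈ S ⊎ 2 * x + 1 ∈ S → ∃[ c ] (Child x c × c ∈ S)
  pick (inj₁ p) = _ , inj₁ refl , p
  pick (inj₂ p) = _ , inj₂ refl , p

levelVertex : ∀ m → Fin (2 ^ m) → ℕ
levelVertex m i = 2 ^ m + toℕ i

levelVertex-on-level : ∀ m i → OnLevel m (levelVertex m i)
levelVertex-on-level m i = m≤m+n (2 ^ m) (toℕ i) , (begin-strict
  2 ^ m + toℕ i       <⟨ +-monoʳ-< (2 ^ m) (toℕ<n i) ⟩
  2 ^ m + 2 ^ m       ≡⟨ cong (2 ^ m +_) (+-identityʳ (2 ^ m)) ⟨
  2 * 2 ^ m           ≡⟨ 2^[k+1]≡2*2^k m ⟨
  2 ^ (m + 1)         ∎)
  where open ≤-Reasoning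

levelVertex-injective : ∀ m → Injective _≡_ _≡_ (levelVertex m)
levelVertex-injective m e = toℕ-injective (+-cancelˡ-≡ (2 ^ m) _ _ e)

lemma11 : (n : ℕ) → 1 ≤ n → (S : List ℕ) → IsMinLocDom n S →
    2 ^ (n ∸ 1) ≤ countLevel n S
lemma11 (suc m) _ S (ld , _) =
  injective-members-≤-length chosen chosen-injective chosen-on-level
  where
  child-in-S : ∀ i → ∃[ c ] (Child (levelVertex m i) c × c ∈ S)
  child-in-S i = locDom-contains-child {m} {S} ld (levelVertex-on-level m i)
  chosen : Fin (2 ^ m) → ℕ
  chosen i = proj₁ (child-in-S i)
  chosen-child : ∀ i → Child (levelVertex m i) (chosen i)
  chosen-child i = proj₁ (proj₂ (child-in-S i))
  chosen-injective : Injective _≡_ _≡_ chosen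
  chosen-injective {i} {j} e = levelVertex-injective m
    (child-injective (chosen-child i) (subst (Child (levelVertex m j)) (sym e) (chosen-child j)))
  chosen-on-level : ∀ i → chosen i ∈ filter (onLevel? (suc m)) S
  chosen-on-level i = ∈-filter⁺ (onLevel? (suc m)) (proj₂ (proj₂ (child-in-S i)))
    (child-on-next-level {m} (levelVertex-on-level m i) (chosen-child i))
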